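{- Let $G$ be a simple bipartite graph with bipartition $\{X,Y\}$ such that $3\leq c\leq\deg_G(x)\leq k$ for every $x\in X$, and $|N_G(y)\cap N_G(z)|\geq k$ for every pair of distinct $y,z\in Y$. Let $\mu=\max_{u\in X}|\{v\in X: N_G(u)=N_G(v)\}|$. Then: (i) $|N_G(y)|\geq \frac{k(|Y|-1)}{k-1}$ for every $y\in Y$; (ii) $|N_G(B)\cap N_G(Y\setminus B)|\geq\frac{2|B|(|Y|-|B|)}{k-1}$ for every $B\subseteq Y$; (iii) if $|Y|\geq \mu(k-1)(2^{k-c-1}-2^c+1)$, then $G$ has a spanning tree $F$ with $\deg_F(x)\leq 2$ for every $x\in X$.
   Context: $N_G(A)$ denotes the set of vertices having a neighbor in $A$; $N_G(y)=N_G(\{y\})$. -}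

module Defs where

open import Data.Nat using (ℕ; zero; suc; _≤_; _⊔_)
open import Data.Bool using (Bool; true; false; _∧_; _∨_; T)
open import Data.Bool.Properties using () renaming (_≟_ to _≟ᵇ_)
open import Data.Fin using (Fin; zero; suc; inject₁; fromℕ)
open import Data.Fin.Subset using (Subset; ∣_∣)
open import Data.Vec using (tabulate)
open import Data.Vec.Properties using (≡-dec)
open import Data.Sum using (_⊎_; inj₁; inj₂)
open import Data.Empty using (⊥)
open import Data.Product using (Σ; _×_)
open import Function.Definitions using (Injective)
open import Relation.Binary.PropositionalEquality using (_≡_)
open import Relation.Nullary using (¬_; does)

-- A finite simple bipartite graph with bipartition {X, Y}, X = Fin m, Y = Fin n,
-- given by its edge indicator E x y (true iff x ∈ X is adjacent to y ∈ Y).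
BipGraph : ℕ → ℕ → Set
BipGraph m n = Fin m → Fin n → Bool

anyᵇ : ∀ {n} → (Fin n → Bool) → Bool
anyᵇ {zero} f = false
anyᵇ {suc n} f = f zero ∨ anyᵇ (λ i → f (suc i))

maxOver : ∀ {m} → (Fin m → ℕ) → ℕ
maxOver {zero} f = 0
maxOver {suc m} f = f zero ⊔ maxOver (λ i → f (suc i))

module _ {m n : ℕ} (G : BipGraph m n) where

  NX : Fin m → Subset n
  NX x = tabulate (G x)

  NY : Fin n → Subset m
  NY y = tabulate (λ x → G x y)

  NB : Subset n → Subset m
  NB B = tabulate (λ x → anyᵇ (λ y → Data.Vec.lookup B y ∧ G x y))

  degX : Fin m → ℕ
  degX x = ∣ NX x ∣

  twins : Fin m → ℕ
  twins u = ∣ tabulate (λ v → does (≡-dec _≟ᵇ_ (NX u) (NX v))) ∣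

  μ : ℕ
  μ = maxOver twins

Vtx : ℕ → ℕ → Set
Vtx m n = Fin m ⊎ Fin n

module _ {m n : ℕ} (F : BipGraph m n) where

  Adj : Vtx m n → Vtx m n → Set
  Adj (inj₁ x) (inj₂ y) = T (F x y)
  Adj (inj₂ y) (inj₁ x) = T (F x y)
  Adj (inj₁ _) (inj₁ _) = ⊥
  Adj (inj₂ _) (inj₂ _) = ⊥

  data Walk : Vtx m n → Vtx m n → Set where
    here  : ∀ {u} → Walk u u
    step  : ∀ {u v w} → Adj u v → Walk v w → Walk u w

  Connected : Set
  Connected = ∀ u v → Walk u v

  -- a cycle c_0 c_1 … c_L (L ≥ 2, i.e. at least 3 vertices), pairwise distinct,
  -- with c_i ~ c_{i+1} and c_L ~ c_0
  record Cycle : Set where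
    field
      L      : ℕ
      long   : 2 ≤ L
      c      : Fin (suc L) → Vtx m n
      inj    : Injective _≡_ _≡_ c
      adj    : ∀ (i : Fin L) → Adj (c (inject₁ i)) (c (suc i))
      close  : Adj (c (fromℕ L)) (c zero)

  Acyclic : Set
  Acyclic = ¬ Cycle

  IsTree : Set
  IsTree = Connected × Acyclic

IsSpanningTree : ∀ {m n} → BipGraph m n → BipGraph m n → Set
IsSpanningTree {m} {n} G F = (∀ x y → T (F x y) → T (G x y)) × IsTree F

-- Double counting the paths y – x – z of G.  If y ∉ S, the vertices of S have at least
-- k |S| common neighbours with y in total, and they all lie in N(y) ∩ N(S); each such x
-- has at most k − 1 neighbours in S, because it also sees y.  Hence
-- k |S| ≤ (k − 1) |N(y) ∩ N(S)|, and S = Y ∖ {y} gives (i).  Counting instead over y ∈ B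
-- and z ∉ B, a vertex x with a neighbours in B and b outside is counted a b times, where
-- a + b ≤ k and so 2 a b ≤ k (k − 1); this is (ii).
--
-- For (iii) list Y as y₀, y₁, …  The bound with S = {y₀, …, y_j} gives more than j
-- vertices of X adjacent to y_{j+1} and to an earlier y, so distinct such "linkers" can be
-- chosen greedily.  The linkers, each joined to its two ends, together with every other x
-- joined to one neighbour, form a spanning tree: it is connected through y₀, and acyclic
-- because the vertices can be ranked so that each has at most one neighbour of lower rank,
-- which is impossible for the top-ranked vertex of a cycle.

module Submission where

open import Defs
open import Data.Nat using (ℕ; _≤_; _*_; _∸_; _^_)
open import Data.Integer using (+_; _-_) renaming (_*_ to _*ℤ_; _+_ to _+ℤ_; _≤_ to _≤ℤ_)
open import Data.Fin using (Fin)
open import Data.Fin.Subset using (Subset; ∣_∣; _∩_; ∁)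
open import Data.Product using (Σ; _×_)
open import Relation.Binary.PropositionalEquality using (_≢_)

open import Data.Bool using (Bool; true; false; _∧_; T)
open import Data.Bool.Properties using (T-≡; T-∧; T-∨)
open import Data.Fin as Fin using (zero; suc; toℕ; fromℕ; inject₁)
open import Data.Fin.Properties using (any?; toℕ<n) renaming (suc-injective to Fin-suc-injective)
open import Data.Fin.Subset using (⁅_⁆; _∪_; _⊆_; _∈_; _∉_; ⊥; inside; Nonempty) renaming (_-_ to _∖_)
open import Data.Fin.Subset.Properties
open import Data.Nat using (zero; suc; _+_; _<_; z≤n; s≤s)
open import Data.Nat.Properties
open import Data.Nat.Tactic.RingSolver using (solve-∀)
open import Data.Product using (_,_; ∃; ∃₂; proj₁; proj₂)
open import Data.Sum using (_⊎_; inj₁; inj₂)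
open import Data.Vec using ([]; _∷_; lookup; tabulate; there)
open import Data.Vec.Properties using (lookup∘tabulate; tabulate∘lookup; lookup-zipWith; []=⇒lookup; lookup⇒[]=)
open import Function using (_⇔_; mk⇔; Equivalence; _∘_; case_of_)
open import Function.Definitions using (Injective)
open import Relation.Binary.PropositionalEquality
open import Relation.Nullary using (yes; no; contradiction; ¬?; _×-dec_)
open import Algebra.Properties.Semiring.Sum +-*-semiring
  using (sum; sum-syntax; sum-cong-≗; ∑-comm; *-distribˡ-sum; *-distribʳ-sum)

open Equivalence using (to; from)

χ : Bool → ℕ
χ true  = 1
χ false = 0

χ-∧ : ∀ a b → χ (a ∧ b) ≡ χ a * χ b
χ-∧ true  b = sym (+-identityʳ (χ b))
χ-∧ false b = refl

∑-mono-≤ : ∀ {N} {f g : Fin N → ℕ} → (∀ i → f i ≤ g i) → sum f ≤ sum g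
∑-mono-≤ {zero}  f≤g = z≤n
∑-mono-≤ {suc N} f≤g = +-mono-≤ (f≤g zero) (∑-mono-≤ (f≤g ∘ suc))

∑-transpose : ∀ {M N} (a : Fin M → Fin N → ℕ) (b : Fin M → ℕ) (t : Fin N → ℕ) →
              ∑[ z < N ] (t z * ∑[ x < M ] (a x z * b x)) ≡ ∑[ x < M ] (b x * ∑[ z < N ] (a x z * t z))
∑-transpose {M} {N} a b t = begin
  ∑[ z < N ] (t z * ∑[ x < M ] (a x z * b x))  ≡⟨ sum-cong-≗ (λ z → *-distribˡ-sum (t z) (λ x → a x z * b x)) ⟩
  ∑[ z < N ] ∑[ x < M ] (t z * (a x z * b x))  ≡⟨ ∑-comm (λ z x → t z * (a x z * b x)) ⟩
  ∑[ x < M ] ∑[ z < N ] (t z * (a x z * b x))  ≡⟨ sum-cong-≗ (λ x → sum-cong-≗ (λ z → rearrange (t z) (a x z) (b x))) ⟩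
  ∑[ x < M ] ∑[ z < N ] (b x * (a x z * t z))  ≡⟨ sum-cong-≗ (λ x → *-distribˡ-sum (b x) (λ z → a x z * t z)) ⟨
  ∑[ x < M ] (b x * ∑[ z < N ] (a x z * t z))  ∎
  where
  open ≡-Reasoning
  rearrange : ∀ p q r → p * (q * r) ≡ r * (q * p)
  rearrange = solve-∀

∣p∣≡∑χ : ∀ {N} (p : Subset N) → ∣ p ∣ ≡ ∑[ i < N ] χ (lookup p i)
∣p∣≡∑χ []          = refl
∣p∣≡∑χ (true  ∷ p) = cong suc (∣p∣≡∑χ p)
∣p∣≡∑χ (false ∷ p) = ∣p∣≡∑χ p

∣p∩q∣≡∑ : ∀ {N} (p q : Subset N) → ∣ p ∩ q ∣ ≡ ∑[ i < N ] (χ (lookup p i) * χ (lookup q i))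
∣p∩q∣≡∑ p q = trans (∣p∣≡∑χ (p ∩ q)) (sum-cong-≗ λ i →
  trans (cong χ (lookup-zipWith _∧_ i p q)) (χ-∧ (lookup p i) (lookup q i)))

∣tabulate∩p∣≡∑ : ∀ {N} (f : Fin N → Bool) (p : Subset N) →
                 ∣ tabulate f ∩ p ∣ ≡ ∑[ i < N ] (χ (f i) * χ (lookup p i))
∣tabulate∩p∣≡∑ f p = trans (∣p∩q∣≡∑ (tabulate f) p)
  (sum-cong-≗ λ i → cong (λ b → χ b * χ (lookup p i)) (lookup∘tabulate f i))

∣p∪q∣≤∣p∣+∣q∣ : ∀ {N} (p q : Subset N) → ∣ p ∪ q ∣ ≤ ∣ p ∣ + ∣ q ∣
∣p∪q∣≤∣p∣+∣q∣ []          []          = z≤n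
∣p∪q∣≤∣p∣+∣q∣ (true  ∷ p) (s ∷ q)     = s≤s (≤-trans (∣p∪q∣≤∣p∣+∣q∣ p q) (+-monoʳ-≤ ∣ p ∣ (∣p∣≤∣x∷p∣ s q)))
∣p∪q∣≤∣p∣+∣q∣ (false ∷ p) (true  ∷ q) = ≤-trans (s≤s (∣p∪q∣≤∣p∣+∣q∣ p q)) (≤-reflexive (sym (+-suc ∣ p ∣ ∣ q ∣)))
∣p∪q∣≤∣p∣+∣q∣ (false ∷ p) (false ∷ q) = ∣p∪q∣≤∣p∣+∣q∣ p q

∣p∩q∣+∣p∩∁q∣≡∣p∣ : ∀ {N} (p q : Subset N) → ∣ p ∩ q ∣ + ∣ p ∩ ∁ q ∣ ≡ ∣ p ∣
∣p∩q∣+∣p∩∁q∣≡∣p∣ []          []          = refl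
∣p∩q∣+∣p∩∁q∣≡∣p∣ (true  ∷ p) (true  ∷ q) = cong suc (∣p∩q∣+∣p∩∁q∣≡∣p∣ p q)
∣p∩q∣+∣p∩∁q∣≡∣p∣ (true  ∷ p) (false ∷ q) = trans (+-suc ∣ p ∩ q ∣ _) (cong suc (∣p∩q∣+∣p∩∁q∣≡∣p∣ p q))
∣p∩q∣+∣p∩∁q∣≡∣p∣ (false ∷ p) (_     ∷ q) = ∣p∩q∣+∣p∩∁q∣≡∣p∣ p q

∣p∩q∣<∣p∣ : ∀ {N} {y : Fin N} (p q : Subset N) → y ∈ p → y ∉ q → ∣ p ∩ q ∣ < ∣ p ∣
∣p∩q∣<∣p∣ {y = y} p q y∈p y∉q = ≤-<-trans (p⊆q⇒∣p∣≤∣q∣ p∩q⊆p∖y) (x∈p⇒∣p-x∣<∣p∣ y∈p)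
  where
  p∩q⊆p∖y : p ∩ q ⊆ p ∖ y
  p∩q⊆p∖y z∈p∩q with x∈p∩q⁻ p q z∈p∩q
  ... | z∈p , z∈q = x∈p∧x≢y⇒x∈p-y z∈p (λ { refl → y∉q z∈q })

Nonempty⊎∣p∣≡0 : ∀ {N} (p : Subset N) → Nonempty p ⊎ ∣ p ∣ ≡ 0
Nonempty⊎∣p∣≡0 {N} p with nonempty? p
... | yes ne   = inj₁ ne
... | no empty = inj₂ (trans (cong ∣_∣ (Empty-unique empty)) (∣⊥∣≡0 N))

∣p∣<∣q∣⇒∃∈q∖p : ∀ {N} (p q : Subset N) → ∣ p ∣ < ∣ q ∣ → ∃ λ x → x ∈ q × x ∉ p
∣p∣<∣q∣⇒∃∈q∖p p q ∣p∣<∣q∣ with any? (λ x → x ∈? q ×-dec ¬? (x ∈? p))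
... | yes found = found
... | no  none  = contradiction (p⊆q⇒∣p∣≤∣q∣ q⊆p) (<⇒≱ ∣p∣<∣q∣)
  where
  q⊆p : q ⊆ p
  q⊆p {x} x∈q with x ∈? p
  ... | yes x∈p = x∈p
  ... | no  x∉p = contradiction (x , x∈q , x∉p) none

∈⇔T-lookup : ∀ {N} {i : Fin N} (p : Subset N) → i ∈ p ⇔ T (lookup p i)
∈⇔T-lookup {i = i} p = mk⇔ (from T-≡ ∘ []=⇒lookup) (lookup⇒[]= i p ∘ to T-≡)

∈tabulate⇔ : ∀ {N} {i : Fin N} (f : Fin N → Bool) → i ∈ tabulate f ⇔ T (f i)
∈tabulate⇔ {i = i} f = mk⇔ (subst T (lookup∘tabulate f i) ∘ to (∈⇔T-lookup (tabulate f)))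
                           (from (∈⇔T-lookup (tabulate f)) ∘ subst T (sym (lookup∘tabulate f i)))

lookup≡false⇒∉ : ∀ {N} {i : Fin N} {p : Subset N} → lookup p i ≡ false → i ∉ p
lookup≡false⇒∉ eq i∈p = contradiction (trans (sym ([]=⇒lookup i∈p)) eq) λ ()

anyᵇ⁺ : ∀ {N} (f : Fin N → Bool) {i : Fin N} → T (f i) → T (anyᵇ f)
anyᵇ⁺ f {zero}  t = from T-∨ (inj₁ t)
anyᵇ⁺ f {suc i} t = from T-∨ (inj₂ (anyᵇ⁺ (f ∘ suc) t))

anyᵇ⁻ : ∀ {N} (f : Fin N → Bool) → T (anyᵇ f) → ∃ λ i → T (f i)
anyᵇ⁻ {suc N} f t with to T-∨ t
... | inj₁ t₀ = zero , t₀
... | inj₂ ts with anyᵇ⁻ (f ∘ suc) ts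
...   | i , tᵢ = suc i , tᵢ

2*m*n≤[m+n]*[m+n∸1] : ∀ m n → 2 * (m * n) ≤ (m + n) * (m + n ∸ 1)
2*m*n≤[m+n]*[m+n∸1] zero    n       = z≤n
2*m*n≤[m+n]*[m+n∸1] (suc m) zero    = ≤-trans (≤-reflexive (cong (2 *_) (*-zeroʳ (suc m)))) z≤n
2*m*n≤[m+n]*[m+n∸1] (suc m) (suc n) = begin
  2 * (suc m * suc n)                            ≤⟨ m≤m+n _ (m * m + n * n + m + n) ⟩
  2 * (suc m * suc n) + (m * m + n * n + m + n)  ≡⟨ expand m n ⟩
  (suc m + suc n) * (m + suc n)                  ∎
  where
  open ≤-Reasoning
  expand : ∀ m n → 2 * (suc m * suc n) + (m * m + n * n + m + n) ≡ (suc m + suc n) * (m + suc n)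
  expand = solve-∀

[1+k]*m≤k*n⇒m≤n : ∀ k {m n} → suc k * m ≤ k * n → m ≤ n
[1+k]*m≤k*n⇒m≤n zero    {m} le = ≤-trans (≤-trans (m≤m+n m 0) le) z≤n
[1+k]*m≤k*n⇒m≤n (suc k) {m} le = *-cancelˡ-≤ (suc k) (≤-trans (*-monoˡ-≤ m (n≤1+n (suc k))) le)

module _ {m n : ℕ} (G : BipGraph m n) where

  ∈NB⁺ : ∀ {S x y} → y ∈ NX G x ∩ S → x ∈ NB G S
  ∈NB⁺ {S} {x} y∈ with x∈p∩q⁻ (NX G x) S y∈
  ... | y∈NX , y∈S = from (∈tabulate⇔ _) (anyᵇ⁺ (λ y → lookup S y ∧ G x y)
                       (from T-∧ (to (∈⇔T-lookup S) y∈S , to (∈tabulate⇔ (G x)) y∈NX)))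

  ∈NB⁻ : ∀ {S x} → x ∈ NB G S → ∃ λ y → y ∈ S × T (G x y)
  ∈NB⁻ {S} x∈ with anyᵇ⁻ _ (to (∈tabulate⇔ _) x∈)
  ... | y , t with to T-∧ t
  ...   | y∈S , Gxy = y , from (∈⇔T-lookup S) y∈S , Gxy

  ∉NB⇒∣NX∩S∣≡0 : ∀ {S x} → x ∉ NB G S → ∣ NX G x ∩ S ∣ ≡ 0
  ∉NB⇒∣NX∩S∣≡0 {S} {x} x∉ with Nonempty⊎∣p∣≡0 (NX G x ∩ S)
  ... | inj₁ (_ , y∈) = contradiction (∈NB⁺ y∈) x∉
  ... | inj₂ ∣NX∩S∣≡0 = ∣NX∩S∣≡0

  ∑codegree≡∑degree : ∀ (S : Subset n) y →
    ∑[ z < n ] (χ (lookup S z) * ∣ NY G y ∩ NY G z ∣) ≡ ∑[ x < m ] (χ (G x y) * ∣ NX G x ∩ S ∣)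
  ∑codegree≡∑degree S y = begin
    ∑[ z < n ] (χ (lookup S z) * ∣ NY G y ∩ NY G z ∣)
      ≡⟨ sum-cong-≗ (λ z → cong (χ (lookup S z) *_) (codegree≡∑ z)) ⟩
    ∑[ z < n ] (χ (lookup S z) * ∑[ x < m ] (χ (G x z) * χ (G x y)))
      ≡⟨ ∑-transpose (λ x z → χ (G x z)) (λ x → χ (G x y)) (λ z → χ (lookup S z)) ⟩
    ∑[ x < m ] (χ (G x y) * ∑[ z < n ] (χ (G x z) * χ (lookup S z)))
      ≡⟨ sum-cong-≗ (λ x → cong (χ (G x y) *_) (∣tabulate∩p∣≡∑ (G x) S)) ⟨
    ∑[ x < m ] (χ (G x y) * ∣ NX G x ∩ S ∣) ∎
    where
    open ≡-Reasoning
    codegree≡∑ : ∀ z → ∣ NY G y ∩ NY G z ∣ ≡ ∑[ x < m ] (χ (G x z) * χ (G x y))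
    codegree≡∑ z = trans (∣tabulate∩p∣≡∑ (λ x → G x y) (NY G z)) (sum-cong-≗ λ x →
      trans (cong (λ b → χ (G x y) * χ b) (lookup∘tabulate (λ x → G x z) x)) (*-comm (χ (G x y)) (χ (G x z))))

module _ {m n k₁ : ℕ} (G : BipGraph m n)
  (deg≤k : ∀ x → degX G x ≤ suc k₁)
  (codeg≥k : ∀ y z → y ≢ z → suc k₁ ≤ ∣ NY G y ∩ NY G z ∣)
  where

  k∣S∣≤∑codegree : ∀ {y S} → y ∉ S → suc k₁ * ∣ S ∣ ≤ ∑[ z < n ] (χ (lookup S z) * ∣ NY G y ∩ NY G z ∣)
  k∣S∣≤∑codegree {y} {S} y∉S = begin
    suc k₁ * ∣ S ∣                                     ≡⟨ cong (suc k₁ *_) (∣p∣≡∑χ S) ⟩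
    suc k₁ * ∑[ z < n ] χ (lookup S z)                 ≡⟨ *-distribˡ-sum (suc k₁) (λ z → χ (lookup S z)) ⟩
    ∑[ z < n ] (suc k₁ * χ (lookup S z))               ≤⟨ ∑-mono-≤ termwise ⟩
    ∑[ z < n ] (χ (lookup S z) * ∣ NY G y ∩ NY G z ∣)  ∎
    where
    open ≤-Reasoning
    termwise : ∀ z → suc k₁ * χ (lookup S z) ≤ χ (lookup S z) * ∣ NY G y ∩ NY G z ∣
    termwise z with lookup S z in z∈S
    ... | false = ≤-reflexive (*-zeroʳ (suc k₁))
    ... | true  = subst₂ _≤_ (sym (*-identityʳ (suc k₁))) (sym (+-identityʳ _))
                    (codeg≥k y z (λ { refl → y∉S (lookup⇒[]= z S z∈S) }))

  ∣N[x]∩S∣≤k-1 : ∀ {y S} x → y ∉ S → χ (G x y) * ∣ NX G x ∩ S ∣ ≤ k₁ * (χ (G x y) * χ (lookup (NB G S) x))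
  ∣N[x]∩S∣≤k-1 {y} {S} x y∉S with G x y in Gxy | lookup (NB G S) x in x∈NB
  ... | false | _     = z≤n
  ... | true  | false = ≤-trans (≤-reflexive (trans (+-identityʳ _) (∉NB⇒∣NX∩S∣≡0 G (lookup≡false⇒∉ x∈NB)))) z≤n
  ... | true  | true  = subst₂ _≤_ (sym (+-identityʳ _)) (sym (*-identityʳ k₁))
                          (≤-pred (≤-trans (∣p∩q∣<∣p∣ (NX G x) S y∈NX y∉S) (deg≤k x)))
    where
    y∈NX : y ∈ NX G x
    y∈NX = from (∈tabulate⇔ (G x)) (subst T (sym Gxy) _)

  k∣S∣≤[k-1]∣N[y]∩N[S]∣ : ∀ {y S} → y ∉ S → suc k₁ * ∣ S ∣ ≤ k₁ * ∣ NY G y ∩ NB G S ∣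
  k∣S∣≤[k-1]∣N[y]∩N[S]∣ {y} {S} y∉S = begin
    suc k₁ * ∣ S ∣                                         ≤⟨ k∣S∣≤∑codegree y∉S ⟩
    ∑[ z < n ] (χ (lookup S z) * ∣ NY G y ∩ NY G z ∣)      ≡⟨ ∑codegree≡∑degree G S y ⟩
    ∑[ x < m ] (χ (G x y) * ∣ NX G x ∩ S ∣)                ≤⟨ ∑-mono-≤ (λ x → ∣N[x]∩S∣≤k-1 x y∉S) ⟩
    ∑[ x < m ] (k₁ * (χ (G x y) * χ (lookup (NB G S) x)))  ≡⟨ *-distribˡ-sum {m} k₁ _ ⟨
    k₁ * ∑[ x < m ] (χ (G x y) * χ (lookup (NB G S) x))    ≡⟨ cong (k₁ *_) (∣tabulate∩p∣≡∑ (λ x → G x y) (NB G S)) ⟨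
    k₁ * ∣ NY G y ∩ NB G S ∣                               ∎
    where open ≤-Reasoning

  k[n-1]≤[k-1]∣N[y]∣ : ∀ y → suc k₁ * (n ∸ 1) ≤ k₁ * ∣ NY G y ∣
  k[n-1]≤[k-1]∣N[y]∣ y = begin
    suc k₁ * (n ∸ 1)                  ≡⟨ cong (λ s → suc k₁ * (n ∸ s)) (∣⁅x⁆∣≡1 y) ⟨
    suc k₁ * (n ∸ ∣ ⁅ y ⁆ ∣)          ≡⟨ cong (suc k₁ *_) (∣∁p∣≡n∸∣p∣ ⁅ y ⁆) ⟨
    suc k₁ * ∣ ∁ ⁅ y ⁆ ∣              ≤⟨ k∣S∣≤[k-1]∣N[y]∩N[S]∣ (x∈p⇒x∉∁p (x∈⁅x⁆ y)) ⟩
    k₁ * ∣ NY G y ∩ NB G (∁ ⁅ y ⁆) ∣  ≤⟨ *-monoʳ-≤ k₁ (∣p∩q∣≤∣p∣ (NY G y) _) ⟩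
    k₁ * ∣ NY G y ∣                   ∎
    where open ≤-Reasoning

  2∣N[x]∩∁B∣∣N[x]∩B∣≤k[k-1] : ∀ B x →
    2 * (∣ NX G x ∩ ∁ B ∣ * ∣ NX G x ∩ B ∣) ≤ suc k₁ * k₁ * (χ (lookup (NB G B) x) * χ (lookup (NB G (∁ B)) x))
  2∣N[x]∩∁B∣∣N[x]∩B∣≤k[k-1] B x with lookup (NB G B) x in x∈NB | lookup (NB G (∁ B)) x in x∈NB∁
  ... | false | _ = ≤-trans (≤-reflexive (trans
    (cong (λ a → 2 * (∣ NX G x ∩ ∁ B ∣ * a)) (∉NB⇒∣NX∩S∣≡0 G (lookup≡false⇒∉ x∈NB)))
    (cong (2 *_) (*-zeroʳ ∣ NX G x ∩ ∁ B ∣)))) z≤n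
  ... | true | false = ≤-trans (≤-reflexive
    (cong (λ c → 2 * (c * ∣ NX G x ∩ B ∣)) (∉NB⇒∣NX∩S∣≡0 G (lookup≡false⇒∉ x∈NB∁)))) z≤n
  ... | true | true = begin
    2 * (c * a)            ≤⟨ 2*m*n≤[m+n]*[m+n∸1] c a ⟩
    (c + a) * (c + a ∸ 1)  ≤⟨ *-mono-≤ c+a≤k (∸-monoˡ-≤ 1 c+a≤k) ⟩
    suc k₁ * k₁            ≡⟨ *-identityʳ (suc k₁ * k₁) ⟨
    suc k₁ * k₁ * 1        ∎
    where
    open ≤-Reasoning
    a = ∣ NX G x ∩ B ∣
    c = ∣ NX G x ∩ ∁ B ∣
    c+a≤k : c + a ≤ suc k₁
    c+a≤k = subst (_≤ suc k₁) (trans (sym (∣p∩q∣+∣p∩∁q∣≡∣p∣ (NX G x) B)) (+-comm a c)) (deg≤k x)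

  2∣B∣∣∁B∣≤[k-1]∣N[B]∩N[∁B]∣ : ∀ B → 2 * ∣ B ∣ * ∣ ∁ B ∣ ≤ k₁ * ∣ NB G B ∩ NB G (∁ B) ∣
  2∣B∣∣∁B∣≤[k-1]∣N[B]∩N[∁B]∣ B = *-cancelˡ-≤ (suc k₁) (begin
    suc k₁ * (2 * ∣ B ∣ * ∣ ∁ B ∣)
      ≡⟨ regroup (suc k₁) ∣ B ∣ ∣ ∁ B ∣ ⟩
    2 * (∣ B ∣ * (suc k₁ * ∣ ∁ B ∣))
      ≡⟨ cong (λ s → 2 * (s * (suc k₁ * ∣ ∁ B ∣))) (∣p∣≡∑χ B) ⟩
    2 * (∑[ y < n ] χ (lookup B y) * (suc k₁ * ∣ ∁ B ∣))
      ≡⟨ cong (2 *_) (*-distribʳ-sum (suc k₁ * ∣ ∁ B ∣) (λ y → χ (lookup B y))) ⟩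
    2 * ∑[ y < n ] (χ (lookup B y) * (suc k₁ * ∣ ∁ B ∣))
      ≤⟨ *-monoʳ-≤ 2 (∑-mono-≤ termwise) ⟩
    2 * ∑[ y < n ] (χ (lookup B y) * ∑[ z < n ] (χ (lookup (∁ B) z) * ∣ NY G y ∩ NY G z ∣))
      ≡⟨ cong (2 *_) (sum-cong-≗ λ y → cong (χ (lookup B y) *_) (∑codegree≡∑degree G (∁ B) y)) ⟩
    2 * ∑[ y < n ] (χ (lookup B y) * ∑[ x < m ] (χ (G x y) * ∣ NX G x ∩ ∁ B ∣))
      ≡⟨ cong (2 *_) (∑-transpose (λ x y → χ (G x y)) (λ x → ∣ NX G x ∩ ∁ B ∣) (λ y → χ (lookup B y))) ⟩
    2 * ∑[ x < m ] (∣ NX G x ∩ ∁ B ∣ * ∑[ y < n ] (χ (G x y) * χ (lookup B y)))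
      ≡⟨ cong (2 *_) (sum-cong-≗ λ x → cong (∣ NX G x ∩ ∁ B ∣ *_) (∣tabulate∩p∣≡∑ (G x) B)) ⟨
    2 * ∑[ x < m ] (∣ NX G x ∩ ∁ B ∣ * ∣ NX G x ∩ B ∣)
      ≡⟨ *-distribˡ-sum 2 (λ x → ∣ NX G x ∩ ∁ B ∣ * ∣ NX G x ∩ B ∣) ⟩
    ∑[ x < m ] (2 * (∣ NX G x ∩ ∁ B ∣ * ∣ NX G x ∩ B ∣))
      ≤⟨ ∑-mono-≤ (2∣N[x]∩∁B∣∣N[x]∩B∣≤k[k-1] B) ⟩
    ∑[ x < m ] (suc k₁ * k₁ * (χ (lookup (NB G B) x) * χ (lookup (NB G (∁ B)) x)))
      ≡⟨ *-distribˡ-sum {m} (suc k₁ * k₁) _ ⟨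
    suc k₁ * k₁ * ∑[ x < m ] (χ (lookup (NB G B) x) * χ (lookup (NB G (∁ B)) x))
      ≡⟨ cong (suc k₁ * k₁ *_) (∣p∩q∣≡∑ (NB G B) (NB G (∁ B))) ⟨
    suc k₁ * k₁ * ∣ NB G B ∩ NB G (∁ B) ∣
      ≡⟨ *-assoc (suc k₁) k₁ _ ⟩
    suc k₁ * (k₁ * ∣ NB G B ∩ NB G (∁ B) ∣) ∎)
    where
    open ≤-Reasoning
    regroup : ∀ k b c → k * (2 * b * c) ≡ 2 * (b * (k * c))
    regroup = solve-∀
    termwise : ∀ y → χ (lookup B y) * (suc k₁ * ∣ ∁ B ∣)
                   ≤ χ (lookup B y) * ∑[ z < n ] (χ (lookup (∁ B) z) * ∣ NY G y ∩ NY G z ∣)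
    termwise y with lookup B y in y∈B
    ... | false = z≤n
    ... | true  = *-monoʳ-≤ 1 (k∣S∣≤∑codegree (x∈p⇒x∉∁p (lookup⇒[]= y B y∈B)))

room-after-choice : ∀ {M N} (C : Fin (suc N) → Subset M) (U : Subset M) (x : Fin M) →
  (∀ j → toℕ j + ∣ U ∣ < ∣ C j ∣) → ∀ j → toℕ j + ∣ U ∪ ⁅ x ⁆ ∣ < ∣ C (suc j) ∣
room-after-choice C U x room j = begin-strict
  toℕ j + ∣ U ∪ ⁅ x ⁆ ∣        ≤⟨ +-monoʳ-≤ (toℕ j) (∣p∪q∣≤∣p∣+∣q∣ U ⁅ x ⁆) ⟩
  toℕ j + (∣ U ∣ + ∣ ⁅ x ⁆ ∣)  ≡⟨ cong (λ s → toℕ j + (∣ U ∣ + s)) (∣⁅x⁆∣≡1 x) ⟩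
  toℕ j + (∣ U ∣ + 1)          ≡⟨ trans (cong (λ s → toℕ j + s) (+-comm ∣ U ∣ 1)) (+-suc (toℕ j) ∣ U ∣) ⟩
  suc (toℕ j) + ∣ U ∣          <⟨ room (suc j) ⟩
  ∣ C (suc j) ∣                ∎
  where open ≤-Reasoning

distinct-representatives : ∀ {M N} (C : Fin N → Subset M) (U : Subset M) →
  (∀ j → toℕ j + ∣ U ∣ < ∣ C j ∣) →
  ∃ λ (f : Fin N → Fin M) → Injective _≡_ _≡_ f × (∀ j → f j ∈ C j) × (∀ j → f j ∉ U)
distinct-representatives {N = zero}  C U room = (λ ()) , (λ {i} → case i of λ ()) , (λ ()) , (λ ())
distinct-representatives {N = suc N} C U room
  with ∣p∣<∣q∣⇒∃∈q∖p U (C zero) (room zero)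
... | x , x∈C₀ , x∉U with distinct-representatives (C ∘ suc) (U ∪ ⁅ x ⁆) (room-after-choice C U x room)
...   | f , f-injective , f∈C , f∉U∪x = g , g-injective , g∈C , g∉U
  where
  x∈U∪x : x ∈ U ∪ ⁅ x ⁆
  x∈U∪x = x∈p∪q⁺ (inj₂ (x∈⁅x⁆ x))
  g : Fin (suc N) → _
  g zero    = x
  g (suc j) = f j
  g-injective : Injective _≡_ _≡_ g
  g-injective {zero}  {zero}  _  = refl
  g-injective {zero}  {suc j} eq = contradiction (subst (_∈ U ∪ ⁅ x ⁆) eq x∈U∪x) (f∉U∪x j)
  g-injective {suc i} {zero}  eq = contradiction (subst (_∈ U ∪ ⁅ x ⁆) (sym eq) x∈U∪x) (f∉U∪x i)
  g-injective {suc i} {suc j} eq = cong suc (f-injective eq)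
  g∈C : ∀ j → g j ∈ C j
  g∈C zero    = x∈C₀
  g∈C (suc j) = f∈C j
  g∉U : ∀ j → g j ∉ U
  g∉U zero    = x∉U
  g∉U (suc j) = f∉U∪x j ∘ p⊆p∪q ⁅ x ⁆

below : ∀ {N} → Fin N → Subset N
below zero    = ⊥
below (suc j) = inside ∷ below j

∣below∣ : ∀ {N} (j : Fin N) → ∣ below j ∣ ≡ toℕ j
∣below∣ {suc N} zero    = ∣⊥∣≡0 (suc N)
∣below∣         (suc j) = cong suc (∣below∣ j)

∈below⇒< : ∀ {N} {i j : Fin N} → i ∈ below j → i Fin.< j
∈below⇒< {j = zero}                     i∈ = contradiction i∈ ∉⊥
∈below⇒< {i = zero}  {suc j} _              = s≤s z≤n
∈below⇒< {i = suc i} {suc j} (there i∈)     = s≤s (∈below⇒< i∈)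

argmax : ∀ {N} (f : Fin (suc N) → ℕ) → ∃ λ i → ∀ j → f j ≤ f i
argmax {zero}  f = zero , λ { zero → ≤-refl }
argmax {suc N} f with argmax (f ∘ suc)
... | i , max with f zero ≤? f (suc i)
...   | yes f₀≤ = suc i , λ { zero → f₀≤ ; (suc j) → max j }
...   | no  f₀≰ = zero  , λ { zero → ≤-refl ; (suc j) → ≤-trans (max j) (<⇒≤ (≰⇒> f₀≰)) }

data LastOrInject₁ : ∀ {N} → Fin (suc N) → Set where
  last  : ∀ {N} → LastOrInject₁ (fromℕ N)
  inner : ∀ {N} (j : Fin N) → LastOrInject₁ (inject₁ j)

lastOrInject₁ : ∀ {N} (i : Fin (suc N)) → LastOrInject₁ i
lastOrInject₁ {zero}  zero    = last
lastOrInject₁ {suc N} zero    = inner zero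
lastOrInject₁ {suc N} (suc i) with lastOrInject₁ i
... | last    = last
... | inner j = inner (suc j)

inject₁-inject₁≢suc-suc : ∀ {N} (j : Fin N) → inject₁ (inject₁ j) ≢ suc (suc j)
inject₁-inject₁≢suc-suc zero    ()
inject₁-inject₁≢suc-suc (suc j) eq = inject₁-inject₁≢suc-suc j (Fin-suc-injective eq)

module _ {m n : ℕ} {F : BipGraph m n} where

  Adj-sym : ∀ u v → Adj F u v → Adj F v u
  Adj-sym (inj₁ _) (inj₂ _) uv = uv
  Adj-sym (inj₂ _) (inj₁ _) uv = uv

  _++ʷ_ : ∀ {u v w} → Walk F u v → Walk F v w → Walk F u w
  here         ++ʷ vw = vw
  step uu′ u′v ++ʷ vw = step uu′ (u′v ++ʷ vw)

  reverseʷ : ∀ {u v} → Walk F u v → Walk F v u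
  reverseʷ here                     = here
  reverseʷ (step {u} {u′} uu′ u′v) = reverseʷ u′v ++ʷ step (Adj-sym u u′ uu′) here

  walks-to-root⇒Connected : ∀ r → (∀ u → Walk F u r) → Connected F
  walks-to-root⇒Connected r to-r u v = to-r u ++ʷ reverseʷ (to-r v)

  cycle-neighbours : ∀ {L} → 2 ≤ L → (c : Fin (suc L) → Vtx m n) →
    (∀ i → Adj F (c (inject₁ i)) (c (suc i))) → Adj F (c (fromℕ L)) (c zero) →
    ∀ i → ∃₂ λ p q → p ≢ q × Adj F (c i) (c p) × Adj F (c i) (c q)
  cycle-neighbours {suc zero} (s≤s ())
  cycle-neighbours {suc (suc L)} _ c adj close i with lastOrInject₁ i
  ... | last          = inject₁ (fromℕ (suc L)) , zero , (λ ()) ,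
                        Adj-sym (c _) (c _) (adj (fromℕ (suc L))) , close
  ... | inner zero    = fromℕ (suc (suc L)) , suc zero , (λ ()) , Adj-sym (c _) (c _) close , adj zero
  ... | inner (suc j) = inject₁ (inject₁ j) , suc (suc j) , inject₁-inject₁≢suc-suc j ,
                        Adj-sym (c _) (c _) (adj (inject₁ j)) , adj (suc j)

  unique-lower-neighbour⇒Acyclic : (rank : Vtx m n → ℕ) →
    (∀ {u v} → Adj F u v → rank u ≢ rank v) →
    (∀ {v u w} → Adj F v u → Adj F v w → rank u < rank v → rank w < rank v → u ≡ w) →
    Acyclic F
  unique-lower-neighbour⇒Acyclic rank rank-≢ lower-unique
    record { long = long ; c = c ; inj = inj ; adj = adj ; close = close }
    with argmax (rank ∘ c)
  ... | i , max with cycle-neighbours long c adj close i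
  ...   | p , q , p≢q , i~p , i~q = p≢q (inj (lower-unique i~p i~q (lower i~p) (lower i~q)))
    where
    lower : ∀ {j} → Adj F (c i) (c j) → rank (c j) < rank (c i)
    lower {j} i~j = ≤∧≢⇒< (max j) (λ eq → rank-≢ i~j (sym eq))

record Linking {m n : ℕ} (G : BipGraph m (suc n)) : Set where
  field
    link           : Fin n → Fin m
    link-injective : Injective _≡_ _≡_ link
    back           : Fin n → Fin (suc n)
    back<suc       : ∀ j → back j Fin.< suc j
    link-suc       : ∀ j → T (G (link j) (suc j))
    link-back      : ∀ j → T (G (link j) (back j))

SpanningTreeWithXDegree≤2 : ∀ {m n} → BipGraph m n → Set
SpanningTreeWithXDegree≤2 {m} {n} G = Σ (BipGraph m n) λ F → IsSpanningTree G F × (∀ x → ∣ NX F x ∣ ≤ 2)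

module _ {m n : ℕ} {G : BipGraph m (suc n)} (linking : Linking G)
  (anchor : ∀ x → ∃ λ y → T (G x y)) where

  open Linking linking

  data Role (x : Fin m) : Set where
    linker : ∀ j → link j ≡ x → Role x
    leaf   : (∀ j → link j ≢ x) → Role x

  role : ∀ x → Role x
  role x with any? (λ j → link j Fin.≟ x)
  ... | yes (j , eq) = linker j eq
  ... | no  ∄j       = leaf λ j eq → ∄j (j , eq)

  upʳ downʳ : ∀ {x} → Role x → Fin (suc n)
  upʳ (linker j _)   = suc j
  upʳ {x} (leaf _)   = proj₁ (anchor x)
  downʳ (linker j _) = back j
  downʳ {x} (leaf _) = proj₁ (anchor x)

  -- Y gets even ranks; a linker's odd rank lies between those of its two ends, and a
  -- leaf's odd rank is above all of Y.  So the only lower neighbour of suc j is link j,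
  -- and that of x is down x.
  rankʳ : ∀ {x} → Role x → ℕ
  rankʳ (linker j _) = suc (2 * toℕ j)
  rankʳ (leaf _)     = suc (2 * n)

  up down : Fin m → Fin (suc n)
  up x   = upʳ (role x)
  down x = downʳ (role x)

  F : BipGraph m (suc n)
  F x = lookup (⁅ up x ⁆ ∪ ⁅ down x ⁆)

  rank : Vtx m (suc n) → ℕ
  rank (inj₁ x) = rankʳ (role x)
  rank (inj₂ y) = 2 * toℕ y

  F-adj⁻ : ∀ {x y} → T (F x y) → y ≡ up x ⊎ y ≡ down x
  F-adj⁻ {x} {y} xy with x∈p∪q⁻ ⁅ up x ⁆ ⁅ down x ⁆ (from (∈⇔T-lookup (⁅ up x ⁆ ∪ ⁅ down x ⁆)) xy)
  ... | inj₁ y∈ = inj₁ (x∈⁅y⁆⇒x≡y (up x) y∈)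
  ... | inj₂ y∈ = inj₂ (x∈⁅y⁆⇒x≡y (down x) y∈)

  F-up : ∀ x → T (F x (up x))
  F-up x = to (∈⇔T-lookup (⁅ up x ⁆ ∪ ⁅ down x ⁆)) (x∈p∪q⁺ (inj₁ (x∈⁅x⁆ (up x))))

  F-down : ∀ x → T (F x (down x))
  F-down x = to (∈⇔T-lookup (⁅ up x ⁆ ∪ ⁅ down x ⁆)) (x∈p∪q⁺ (inj₂ (x∈⁅x⁆ (down x))))

  G-upʳ : ∀ {x} (r : Role x) → T (G x (upʳ r))
  G-upʳ (linker j refl) = link-suc j
  G-upʳ {x} (leaf _)    = proj₂ (anchor x)

  G-downʳ : ∀ {x} (r : Role x) → T (G x (downʳ r))
  G-downʳ (linker j refl) = link-back j
  G-downʳ {x} (leaf _)    = proj₂ (anchor x)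

  F⊆G : ∀ x y → T (F x y) → T (G x y)
  F⊆G x y xy with F-adj⁻ xy
  ... | inj₁ refl = G-upʳ (role x)
  ... | inj₂ refl = G-downʳ (role x)

  ∣NX[F]∣≤2 : ∀ x → ∣ NX F x ∣ ≤ 2
  ∣NX[F]∣≤2 x = begin
    ∣ NX F x ∣                     ≡⟨ cong ∣_∣ (tabulate∘lookup (⁅ up x ⁆ ∪ ⁅ down x ⁆)) ⟩
    ∣ ⁅ up x ⁆ ∪ ⁅ down x ⁆ ∣      ≤⟨ ∣p∪q∣≤∣p∣+∣q∣ ⁅ up x ⁆ ⁅ down x ⁆ ⟩
    ∣ ⁅ up x ⁆ ∣ + ∣ ⁅ down x ⁆ ∣  ≡⟨ cong₂ _+_ (∣⁅x⁆∣≡1 (up x)) (∣⁅x⁆∣≡1 (down x)) ⟩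
    2                              ∎
    where open ≤-Reasoning

  ends-of-link : ∀ j → up (link j) ≡ suc j × down (link j) ≡ back j
  ends-of-link j with role (link j)
  ... | leaf ∄j = contradiction refl (∄j j)
  ... | linker i eq with link-injective eq
  ...   | refl = refl , refl

  descend : ∀ {b} y → toℕ y < b → Walk F (inj₂ y) (inj₂ zero)
  descend {suc b} zero    _         = here
  descend {suc b} (suc j) (s≤s j<b) =
    step {v = inj₁ (link j)} (subst (T ∘ F (link j)) (proj₁ (ends-of-link j)) (F-up (link j)))
      (step {v = inj₂ (back j)} (subst (T ∘ F (link j)) (proj₂ (ends-of-link j)) (F-down (link j)))
        (descend (back j) (≤-trans (back<suc j) j<b)))

  to-root : ∀ u → Walk F u (inj₂ zero)
  to-root (inj₁ x) = step {v = inj₂ (up x)} (F-up x) (to-root (inj₂ (up x)))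
  to-root (inj₂ y) = descend y ≤-refl

  rank-≢ : ∀ {u v} → Adj F u v → rank u ≢ rank v
  rank-≢ {inj₁ x} {inj₂ y} _ = X-rank-odd (role x)
    where
    X-rank-odd : (r : Role x) → rankʳ r ≢ 2 * toℕ y
    X-rank-odd (linker j _) eq = even≢odd (toℕ y) (toℕ j) (sym eq)
    X-rank-odd (leaf _)     eq = even≢odd (toℕ y) n (sym eq)
  rank-≢ {inj₂ y} {inj₁ x} xy eq = rank-≢ {inj₁ x} {inj₂ y} xy (sym eq)

  lower-of-Y : ∀ {x y} (r : Role x) → y ≡ upʳ r ⊎ y ≡ downʳ r → rankʳ r < 2 * toℕ y →
               ∃ λ j → link j ≡ x × y ≡ suc j
  lower-of-Y (linker j eq) (inj₁ refl) _  = j , eq , refl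
  lower-of-Y (linker j _)  (inj₂ refl) lt =
    contradiction (≤-trans (*-monoʳ-≤ 2 (≤-pred (back<suc j))) (n≤1+n _)) (<⇒≱ lt)
  lower-of-Y {y = y} (leaf _) _ lt =
    contradiction (≤-trans (*-monoʳ-≤ 2 (≤-pred (toℕ<n y))) (n≤1+n _)) (<⇒≱ lt)

  lower-of-X : ∀ {x y} (r : Role x) → y ≡ upʳ r ⊎ y ≡ downʳ r → 2 * toℕ y < rankʳ r → y ≡ downʳ r
  lower-of-X (linker j _) (inj₁ refl) lt = contradiction (s≤s (+-monoʳ-≤ (toℕ j) (n≤1+n _))) (<⇒≱ lt)
  lower-of-X (linker j _) (inj₂ y≡)   _  = y≡
  lower-of-X (leaf _)     (inj₁ y≡)   _  = y≡
  lower-of-X (leaf _)     (inj₂ y≡)   _  = y≡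

  lower-unique : ∀ {v u w} → Adj F v u → Adj F v w → rank u < rank v → rank w < rank v → u ≡ w
  lower-unique {inj₂ y} {inj₁ x} {inj₁ x′} xy x′y x<y x′<y
    with lower-of-Y (role x) (F-adj⁻ xy) x<y | lower-of-Y (role x′) (F-adj⁻ x′y) x′<y
  ... | j , refl , refl | j′ , refl , refl = refl
  lower-unique {inj₁ x} {inj₂ y} {inj₂ y′} xy xy′ y<x y′<x =
    cong inj₂ (trans (lower-of-X (role x) (F-adj⁻ xy) y<x) (sym (lower-of-X (role x) (F-adj⁻ xy′) y′<x)))

  Linking⇒spanning-tree : SpanningTreeWithXDegree≤2 G
  Linking⇒spanning-tree =
    F , (F⊆G , walks-to-root⇒Connected (inj₂ zero) to-root ,
         unique-lower-neighbour⇒Acyclic rank (λ {u} {v} → rank-≢ {u} {v}) (λ {v} {u} {w} → lower-unique {v} {u} {w}))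
      , ∣NX[F]∣≤2

module _ {m n k₁ : ℕ} (G : BipGraph m (suc n))
  (deg≤k : ∀ x → degX G x ≤ suc k₁)
  (codeg≥k : ∀ y z → y ≢ z → suc k₁ ≤ ∣ NY G y ∩ NY G z ∣)
  where

  candidates : Fin n → Subset m
  candidates j = NY G (suc j) ∩ NB G (below (suc j))

  room : ∀ j → toℕ j + ∣ ⊥ {m} ∣ < ∣ candidates j ∣
  room j = subst (_< ∣ candidates j ∣) (sym (trans (cong (λ s → toℕ j + s) (∣⊥∣≡0 m)) (+-identityʳ (toℕ j))))
    ([1+k]*m≤k*n⇒m≤n k₁ (subst (λ s → suc k₁ * s ≤ k₁ * ∣ candidates j ∣) (∣below∣ (suc j))
      (k∣S∣≤[k-1]∣N[y]∩N[S]∣ G deg≤k codeg≥k (λ j∈ → n≮n _ (∈below⇒< j∈)))))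

  greedy-linking : Linking G
  greedy-linking with distinct-representatives candidates ⊥ room
  ... | link , link-injective , link∈candidates , _ = record
    { link           = link
    ; link-injective = link-injective
    ; back           = λ j → proj₁ (earlier j)
    ; back<suc       = λ j → ∈below⇒< (proj₁ (proj₂ (earlier j)))
    ; link-suc       = λ j → to (∈tabulate⇔ (λ x → G x (suc j))) (proj₁ (link∈ j))
    ; link-back      = λ j → proj₂ (proj₂ (earlier j))
    }
    where
    link∈ : ∀ j → link j ∈ NY G (suc j) × link j ∈ NB G (below (suc j))
    link∈ j = x∈p∩q⁻ _ _ (link∈candidates j)
    earlier : ∀ j → ∃ λ y → y ∈ below (suc j) × T (G (link j) y)
    earlier j = ∈NB⁻ G (proj₂ (link∈ j))

neighbour : ∀ {m n} (G : BipGraph m n) x → 1 ≤ degX G x → ∃ λ y → T (G x y)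
neighbour G x deg≥1 with Nonempty⊎∣p∣≡0 (NX G x)
... | inj₁ (y , y∈) = y , to (∈tabulate⇔ (G x)) y∈
... | inj₂ deg≡0    = contradiction (subst (1 ≤_) deg≡0 deg≥1) λ ()

spanning-tree : ∀ {m n k₁} (G : BipGraph m n) →
  (∀ x → 1 ≤ degX G x) →
  (∀ x → degX G x ≤ suc k₁) →
  (∀ y z → y ≢ z → suc k₁ ≤ ∣ NY G y ∩ NY G z ∣) →
  SpanningTreeWithXDegree≤2 G
spanning-tree {m} {zero} G deg≥1 _ _ =
  G , ((λ _ _ Gxy → Gxy) , (λ u _ → no-vertex u) , (λ C → no-vertex (Cycle.c C zero))) , no-vertex ∘ inj₁
  where
  no-vertex : ∀ {A : Set} → Vtx m 0 → A
  no-vertex (inj₁ x) with deg≥1 x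
  ... | ()
spanning-tree {n = suc n} G deg≥1 deg≤k codeg≥k =
  Linking⇒spanning-tree (greedy-linking G deg≤k codeg≥k) (λ x → neighbour G x (deg≥1 x))

lemma2p4 : (m n c k : ℕ) (G : BipGraph m n)
    → 3 ≤ c → c ≤ k
    → (∀ x → c ≤ degX G x × degX G x ≤ k)
    → (∀ (y z : Fin n) → y ≢ z → k ≤ ∣ NY G y ∩ NY G z ∣)
    → (∀ (y : Fin n) → k * (n ∸ 1) ≤ (k ∸ 1) * ∣ NY G y ∣)
      × (∀ (B : Subset n) → 2 * ∣ B ∣ * (n ∸ ∣ B ∣) ≤ (k ∸ 1) * ∣ NB G B ∩ NB G (∁ B) ∣)
      × ((+ (μ G * (k ∸ 1)) *ℤ ((+ (2 ^ (k ∸ c))) - (+ (2 ^ (c Data.Nat.+ 1))) +ℤ + 2) ≤ℤ + (2 * n))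
         → Σ (BipGraph m n) (λ F → IsSpanningTree G F × (∀ x → ∣ NX F x ∣ ≤ 2)))
lemma2p4 m n c zero     G 3≤c c≤k _   _       = contradiction (≤-trans 3≤c c≤k) λ ()
lemma2p4 m n c (suc k₁) G 3≤c _   deg codeg≥k =
    k[n-1]≤[k-1]∣N[y]∣ G deg≤k codeg≥k
  , (λ B → subst (λ s → 2 * ∣ B ∣ * s ≤ k₁ * ∣ NB G B ∩ NB G (∁ B) ∣) (∣∁p∣≡n∸∣p∣ B)
                 (2∣B∣∣∁B∣≤[k-1]∣N[B]∩N[∁B]∣ G deg≤k codeg≥k B))
  , λ _ → spanning-tree G (λ x → ≤-trans (s≤s z≤n) (≤-trans 3≤c (proj₁ (deg x)))) deg≤k codeg≥k
  where
  deg≤k : ∀ x → degX G x ≤ suc k₁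
  deg≤k x = proj₂ (deg x)
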